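{- Let $p>3$ be a prime, $q=p^h$, $a,b\in\mathbb{F}_{q^2}^*$, and let $$F_{a,b}(X,Y)=\frac{(a^qX^3+X^2+b^q)(bY^3+Y+a)-(a^qY^3+Y^2+b^q)(bX^3+X+a)}{X-Y}.$$ If $F_{a,b}(X,Y)$ factorizes over $\overline{\mathbb{F}_q}$ into (a constant times) four linear factors, then $N_{a,b}(X)=a^qX^3+X^2+b^q$ and $D_{a,b}(X)=bX^3+X+a$ have a nonconstant common factor.
   Context: $\overline{\mathbb{F}_q}$ denotes an algebraic closure of $\mathbb{F}_q$. -}

module Defs where

open import Level using (Level; _⊔_; suc)
open import Algebra.Bundles using (CommutativeRing)
open import Data.Nat as ℕ using (ℕ; zero) renaming (suc to 1+)
open import Data.List using (List; []; _∷_; drop)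
open import Data.List.Relation.Unary.Any using (Any)
open import Data.Product using (∃; _×_)
open import Relation.Nullary using (¬_)

record Field (c ℓ : Level) : Set (suc (c ⊔ ℓ)) where
  field
    commutativeRing : CommutativeRing c ℓ
  open CommutativeRing commutativeRing public
  field
    0≉1     : ¬ (0# ≈ 1#)
    inverse : ∀ x → ¬ (x ≈ 0#) → ∃ λ y → (x * y) ≈ 1#

module _ {c ℓ : Level} (K : Field c ℓ) where
  open Field K

  pow : Carrier → ℕ → Carrier
  pow x zero = 1#
  pow x (1+ n) = x * pow x n

  fromℕ : ℕ → Carrier
  fromℕ zero = 0#
  fromℕ (1+ n) = 1# + fromℕ n

  -- univariate polynomials as coefficient lists c₀ ∷ c₁ ∷ … (ascending degree)
  eval : List Carrier → Carrier → Carrier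
  eval [] x = 0#
  eval (a ∷ as) x = a + x * eval as x

  Nonconstant : List Carrier → Set (c ⊔ ℓ)
  Nonconstant f = Any (λ a → ¬ (a ≈ 0#)) (drop 1 f)

  AlgebraicallyClosed : Set (c ⊔ ℓ)
  AlgebraicallyClosed = ∀ f → Nonconstant f → ∃ λ x → eval f x ≈ 0#

  -- K is an algebraic closure of the prime field 𝔽_p:
  -- algebraically closed, of characteristic p, and algebraic over 𝔽_p
  -- (every element lies in some finite subfield 𝔽_{p^n}, i.e. x^(p^n) = x, n ≥ 1).
  IsAlgebraicClosureOfFp : ℕ → Set (c ⊔ ℓ)
  IsAlgebraicClosureOfFp p =
    AlgebraicallyClosed ×
    (fromℕ p ≈ 0#) ×
    (∀ x → ∃ λ n → (1 ℕ.≤ n) × (pow x (p ℕ.^ n) ≈ x))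

module Submission where

-- Write A = a^q, B = b^q and C = A a - B b. The numerator is (X - Y) F(X, Y) with
--   F = -b X²Y² + A (X²Y + XY²) + C (X² + XY + Y²) + XY + a (X + Y) - B.
-- If F is a product of linear forms α X + β Y + γ, restrict F to the line t ↦ (t β, -t α) on
-- which one factor is constant: the product becomes a cubic in t, while the t⁴-coefficient of F
-- there is -b α²β². Hence α β = 0 for every factor, so each factor involves only one variable and
-- F(x, y) F(0, 0) = F(x, 0) F(0, y). Comparing coefficients gives a C = -A B, C² = b B and
-- a² = -B (C + 1), hence -A C = a b and A² = -b (1 + C), and these say exactly that
--   g = C + A X - b X²   satisfies   b N = g (C - A X)   and   b D = g (-A - b X).
-- Working constructively, "α²β² = 0 ⇒ α β = 0" needs K to have no nilpotents, which holds because
-- every element satisfies x^(pⁿ) = x; and polynomial identities are obtained from values at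
-- points apart from finitely many exceptions, which exist because K is algebraically closed.

open import Defs

open import Level using (Level; _⊔_)
open import Algebra.Bundles using (CommutativeRing)
open import Algebra.Solver.Ring.AlmostCommutativeRing using (fromCommutativeRing; _-Raw-AlmostCommutative⟶_)
open import Data.Integer as ℤ using (ℤ; +_; -[1+_]; _⊖_)
import Data.Integer.Properties as ℤ
open import Data.Maybe using (Maybe; just; nothing)
open import Data.Nat as ℕ using (ℕ; zero; suc; _<_; _≤_)
open import Data.Nat.Primality using (Prime)
open import Data.Fin as Fin using (Fin)
import Data.Nat.Properties as ℕ
open import Relation.Binary.PropositionalEquality as ≡ using (_≡_)
open import Relation.Nullary using (yes; no; ¬_)
open import Data.List using (List; []; _∷_; _∷ʳ_; map; length)
import Data.List.Properties as List
open import Data.List.Relation.Unary.All using (All; []; _∷_)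
open import Data.List.Relation.Unary.Any using (Any; here; there)
open import Data.Product using (∃; _×_; _,_; proj₁; proj₂)
open import Function using (_∘_)

-- The ring solver needs coefficients with decidable equality; ℤ maps into every commutative ring.
module IntegerImage {c ℓ : Level} (R : CommutativeRing c ℓ) where
  open CommutativeRing R
  open import Algebra.Properties.Ring ring using (-‿involutive; -‿distribˡ-*; -‿distribʳ-*; -0#≈0#)
  open import Algebra.Properties.AbelianGroup +-abelianGroup using (⁻¹-∙-comm)
  open import Algebra.Properties.Semiring.Mult.TCOptimised semiring using (1+×; ×-homo-+; ×1-homo-*) renaming (_×_ to _×′_)
  open import Relation.Binary.Reasoning.Setoid setoid

  ⟦_⟧ : ℤ → Carrier
  ⟦ + n ⟧      = n ×′ 1#
  ⟦ -[1+ n ] ⟧ = - (suc n ×′ 1#)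

  -‿homo : ∀ i → ⟦ ℤ.- i ⟧ ≈ - ⟦ i ⟧
  -‿homo (+ zero)  = sym -0#≈0#
  -‿homo (+ suc n) = refl
  -‿homo -[1+ n ]  = sym (-‿involutive _)

  ⊖-homo : ∀ m n → ⟦ m ⊖ n ⟧ ≈ m ×′ 1# - n ×′ 1#
  ⊖-homo m zero = begin
    ⟦ m ⊖ 0 ⟧     ≡⟨ ≡.cong ⟦_⟧ (ℤ.⊖-≥ {m} ℕ.z≤n) ⟩
    m ×′ 1#       ≈⟨ +-identityʳ _ ⟨
    m ×′ 1# + 0#  ≈⟨ +-congˡ -0#≈0# ⟨
    m ×′ 1# - 0#  ∎
  ⊖-homo zero (suc n) = sym (+-identityˡ _)
  ⊖-homo (suc m) (suc n) = begin
    ⟦ suc m ⊖ suc n ⟧          ≡⟨ ≡.cong ⟦_⟧ (ℤ.[1+m]⊖[1+n]≡m⊖n m n) ⟩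
    ⟦ m ⊖ n ⟧                  ≈⟨ ⊖-homo m n ⟩
    x - y                      ≈⟨ +-identityˡ _ ⟨
    0# + (x - y)               ≈⟨ +-congʳ (-‿inverseʳ 1#) ⟨
    (1# - 1#) + (x - y)        ≈⟨ +-assoc 1# (- 1#) _ ⟩
    1# + (- 1# + (x - y))      ≈⟨ +-congˡ (+-assoc (- 1#) x (- y)) ⟨
    1# + ((- 1# + x) - y)      ≈⟨ +-congˡ (+-congʳ (+-comm (- 1#) x)) ⟩
    1# + ((x - 1#) - y)        ≈⟨ +-congˡ (+-assoc x (- 1#) (- y)) ⟩
    1# + (x + (- 1# - y))      ≈⟨ +-assoc 1# x _ ⟨
    (1# + x) + (- 1# - y)      ≈⟨ +-cong (1+× m 1#) (sym (⁻¹-∙-comm 1# y)) ⟨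
    suc m ×′ 1# - (1# + y)     ≈⟨ +-congˡ (-‿cong (1+× n 1#)) ⟨
    suc m ×′ 1# - suc n ×′ 1#  ∎
    where
    x y : Carrier
    x = m ×′ 1#
    y = n ×′ 1#

  +-homo : ∀ i j → ⟦ i ℤ.+ j ⟧ ≈ ⟦ i ⟧ + ⟦ j ⟧
  +-homo (+ m)    (+ n)    = ×-homo-+ 1# m n
  +-homo (+ m)    -[1+ n ] = ⊖-homo m (suc n)
  +-homo -[1+ m ] (+ n)    = trans (⊖-homo n (suc m)) (+-comm _ _)
  +-homo -[1+ m ] -[1+ n ] = begin
    - (suc (suc (m ℕ.+ n)) ×′ 1#)    ≡⟨ ≡.cong (λ k → - (k ×′ 1#)) (ℕ.+-suc (suc m) n) ⟨
    - ((suc m ℕ.+ suc n) ×′ 1#)      ≈⟨ -‿cong (×-homo-+ 1# (suc m) (suc n)) ⟩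
    - (suc m ×′ 1# + suc n ×′ 1#)    ≈⟨ ⁻¹-∙-comm _ _ ⟨
    - (suc m ×′ 1#) - (suc n ×′ 1#)  ∎

  +*-homo : ∀ m j → ⟦ + m ℤ.* j ⟧ ≈ ⟦ + m ⟧ * ⟦ j ⟧
  +*-homo m (+ n) = ≡.subst (λ k → ⟦ k ⟧ ≈ ⟦ + m ⟧ * ⟦ + n ⟧) (ℤ.pos-* m n) (×1-homo-* m n)
  +*-homo m -[1+ n ] = begin
    ⟦ + m ℤ.* -[1+ n ] ⟧           ≡⟨ ≡.cong ⟦_⟧ (ℤ.neg-distribʳ-* (+ m) (+ suc n)) ⟨
    ⟦ ℤ.- (+ m ℤ.* + suc n) ⟧      ≈⟨ -‿homo (+ m ℤ.* + suc n) ⟩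
    - ⟦ + m ℤ.* + suc n ⟧          ≈⟨ -‿cong (+*-homo m (+ suc n)) ⟩
    - (⟦ + m ⟧ * ⟦ + suc n ⟧)      ≈⟨ -‿distribʳ-* _ _ ⟩
    ⟦ + m ⟧ * ⟦ -[1+ n ] ⟧         ∎

  *-homo : ∀ i j → ⟦ i ℤ.* j ⟧ ≈ ⟦ i ⟧ * ⟦ j ⟧
  *-homo (+ m)    j = +*-homo m j
  *-homo -[1+ m ] j = begin
    ⟦ -[1+ m ] ℤ.* j ⟧             ≡⟨ ≡.cong ⟦_⟧ (ℤ.neg-distribˡ-* (+ suc m) j) ⟨
    ⟦ ℤ.- (+ suc m ℤ.* j) ⟧        ≈⟨ -‿homo (+ suc m ℤ.* j) ⟩
    - ⟦ + suc m ℤ.* j ⟧            ≈⟨ -‿cong (+*-homo (suc m) j) ⟩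
    - (⟦ + suc m ⟧ * ⟦ j ⟧)        ≈⟨ -‿distribˡ-* _ _ ⟩
    ⟦ -[1+ m ] ⟧ * ⟦ j ⟧           ∎

  homomorphism : ℤ.+-*-rawRing -Raw-AlmostCommutative⟶ fromCommutativeRing R
  homomorphism = record
    { ⟦_⟧ = ⟦_⟧ ; +-homo = +-homo ; *-homo = *-homo ; -‿homo = -‿homo
    ; 0-homo = refl ; 1-homo = refl }

  ⟦⟧-equal? : ∀ i j → Maybe (⟦ i ⟧ ≈ ⟦ j ⟧)
  ⟦⟧-equal? i j with i ℤ.≟ j
  ... | yes ≡.refl = just refl
  ... | no _       = nothing

module IntegerRingSolver {c ℓ : Level} (R : CommutativeRing c ℓ) where
  open import Algebra.Solver.Ring
    ℤ.+-*-rawRing (fromCommutativeRing R) (IntegerImage.homomorphism R) (IntegerImage.⟦⟧-equal? R) public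

  :0 :1 : ∀ {n} → Polynomial n
  :0 = con (+ 0)
  :1 = con (+ 1)

module Invertibility {c ℓ : Level} (K : Field c ℓ) where
  open Field K
  open import Relation.Binary.Reasoning.Setoid setoid

  Invertible : Carrier → Set (c ⊔ ℓ)
  Invertible x = ∃ λ w → x * w ≈ 1#

  ≉0⇒invertible : ∀ {x} → ¬ x ≈ 0# → Invertible x
  ≉0⇒invertible = inverse _

  invertible⇒≉0 : ∀ {x} → Invertible x → ¬ x ≈ 0#
  invertible⇒≉0 {x} (w , xw≈1) x≈0 = 0≉1 (begin
    0#      ≈⟨ zeroˡ w ⟨
    0# * w  ≈⟨ *-congʳ x≈0 ⟨
    x * w   ≈⟨ xw≈1 ⟩
    1#      ∎)

  invertible-* : ∀ {x y} → Invertible x → Invertible y → Invertible (x * y)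
  invertible-* {x} {y} (v , xv≈1) (w , yw≈1) = v * w , (begin
    x * y * (v * w)    ≈⟨ *-assoc x y (v * w) ⟩
    x * (y * (v * w))  ≈⟨ *-congˡ (x∙yz≈y∙xz y v w) ⟩
    x * (v * (y * w))  ≈⟨ *-assoc x v (y * w) ⟨
    x * v * (y * w)    ≈⟨ *-cong xv≈1 yw≈1 ⟩
    1# * 1#            ≈⟨ *-identityˡ 1# ⟩
    1#                 ∎)
    where open import Algebra.Properties.CommutativeSemigroup *-commutativeSemigroup using (x∙yz≈y∙xz)

  *-cancelʳ-invertible : ∀ {c x y} → Invertible c → x * c ≈ y * c → x ≈ y
  *-cancelʳ-invertible {c} {x} {y} (w , cw≈1) xc≈yc = begin
    x             ≈⟨ *-identityʳ x ⟨
    x * 1#        ≈⟨ *-congˡ cw≈1 ⟨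
    x * (c * w)   ≈⟨ *-assoc x c w ⟨
    x * c * w     ≈⟨ *-congʳ xc≈yc ⟩
    y * c * w     ≈⟨ *-assoc y c w ⟩
    y * (c * w)   ≈⟨ *-congˡ cw≈1 ⟩
    y * 1#        ≈⟨ *-identityʳ y ⟩
    y             ∎

  *-cancelˡ-invertible : ∀ {c x y} → Invertible c → c * x ≈ c * y → x ≈ y
  *-cancelˡ-invertible {c} {x} {y} c-inv cx≈cy =
    *-cancelʳ-invertible c-inv (trans (*-comm x c) (trans cx≈cy (*-comm c y)))

  invertible-*-zero : ∀ {c x} → Invertible c → c * x ≈ 0# → x ≈ 0#
  invertible-*-zero {c} c-inv cx≈0 = *-cancelˡ-invertible c-inv (trans cx≈0 (sym (zeroʳ c)))

module Polynomials {c ℓ : Level} (K : Field c ℓ) where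
  open Field K
  open Invertibility K
  open import Algebra.Properties.Group +-group using (x∙y⁻¹≈ε⇒x≈y; x≈y⇒x∙y⁻¹≈ε; ⁻¹-injective; ε⁻¹≈ε)
  open IntegerRingSolver commutativeRing using (solve; _:=_; _:+_; _:*_; _:-_; :-_; :0; :1)
  open import Relation.Binary.Reasoning.Setoid setoid

  infixl 6 _⊕_
  infixl 7 _⋆_ _⊗_

  _⊕_ : List Carrier → List Carrier → List Carrier
  []      ⊕ g       = g
  (a ∷ f) ⊕ []      = a ∷ f
  (a ∷ f) ⊕ (b ∷ g) = a + b ∷ f ⊕ g

  _⋆_ : Carrier → List Carrier → List Carrier
  a ⋆ f = map (a *_) f

  _⊗_ : List Carrier → List Carrier → List Carrier
  []      ⊗ g = []
  (a ∷ f) ⊗ g = a ⋆ g ⊕ (0# ∷ f ⊗ g)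

  ⊝_ : List Carrier → List Carrier
  ⊝ f = map -_ f

  eval-⊕ : ∀ f g x → eval K (f ⊕ g) x ≈ eval K f x + eval K g x
  eval-⊕ []      g       x = sym (+-identityˡ _)
  eval-⊕ (a ∷ f) []      x = sym (+-identityʳ _)
  eval-⊕ (a ∷ f) (b ∷ g) x = begin
    a + b + x * eval K (f ⊕ g) x
      ≈⟨ +-congˡ (*-congˡ (eval-⊕ f g x)) ⟩
    a + b + x * (eval K f x + eval K g x)
      ≈⟨ solve 5 (λ a b x F G → a :+ b :+ x :* (F :+ G) := a :+ x :* F :+ (b :+ x :* G)) refl a b x _ _ ⟩
    a + x * eval K f x + (b + x * eval K g x) ∎

  eval-⋆ : ∀ a f x → eval K (a ⋆ f) x ≈ a * eval K f x
  eval-⋆ a []      x = sym (zeroʳ a)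
  eval-⋆ a (b ∷ f) x = begin
    a * b + x * eval K (a ⋆ f) x      ≈⟨ +-congˡ (*-congˡ (eval-⋆ a f x)) ⟩
    a * b + x * (a * eval K f x)
      ≈⟨ solve 4 (λ a b x F → a :* b :+ x :* (a :* F) := a :* (b :+ x :* F)) refl a b x _ ⟩
    a * (b + x * eval K f x)          ∎

  eval-⊗ : ∀ f g x → eval K (f ⊗ g) x ≈ eval K f x * eval K g x
  eval-⊗ []      g x = sym (zeroˡ _)
  eval-⊗ (a ∷ f) g x = begin
    eval K (a ⋆ g ⊕ (0# ∷ f ⊗ g)) x
      ≈⟨ eval-⊕ (a ⋆ g) (0# ∷ f ⊗ g) x ⟩
    eval K (a ⋆ g) x + (0# + x * eval K (f ⊗ g) x)
      ≈⟨ +-cong (eval-⋆ a g x) (+-congˡ (*-congˡ (eval-⊗ f g x))) ⟩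
    a * eval K g x + (0# + x * (eval K f x * eval K g x))
      ≈⟨ solve 4 (λ a x F G → a :* G :+ (:0 :+ x :* (F :* G)) := (a :+ x :* F) :* G) refl a x _ _ ⟩
    (a + x * eval K f x) * eval K g x                  ∎

  eval-⊝ : ∀ f x → eval K (⊝ f) x ≈ - eval K f x
  eval-⊝ []      x = sym -0#≈0#
    where open import Algebra.Properties.Ring ring using (-0#≈0#)
  eval-⊝ (a ∷ f) x = begin
    - a + x * eval K (⊝ f) x      ≈⟨ +-congˡ (*-congˡ (eval-⊝ f x)) ⟩
    - a + x * - eval K f x        ≈⟨ solve 3 (λ a x F → :- a :+ x :* :- F := :- (a :+ x :* F)) refl a x _ ⟩
    - (a + x * eval K f x)        ∎

  -- x ≈ s is not decidable; x is apart from s when x - s is invertible.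
  ApartFrom : List Carrier → Carrier → Set _
  ApartFrom S x = All (λ s → Invertible (x - s)) S

  quotient : Carrier → List Carrier → List Carrier
  quotient z []           = []
  quotient z (_ ∷ [])     = []
  quotient z (_ ∷ d ∷ ds) = eval K (d ∷ ds) z ∷ quotient z (d ∷ ds)

  length-quotient : ∀ z c cs → length (quotient z (c ∷ cs)) ≡ length cs
  length-quotient z c []       = ≡.refl
  length-quotient z c (d ∷ ds) = ≡.cong suc (length-quotient z d ds)

  eval-quotient : ∀ z f x → eval K f x ≈ eval K f z + (x - z) * eval K (quotient z f) x
  eval-quotient z []           x = solve 2 (λ x z → :0 := :0 :+ (x :- z) :* :0) refl x z
  eval-quotient z (c ∷ [])     x = solve 3 (λ c x z → c :+ x :* :0 := c :+ z :* :0 :+ (x :- z) :* :0) refl c x z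
  eval-quotient z (c ∷ d ∷ ds) x = begin
    c + x * eval K (d ∷ ds) x
      ≈⟨ +-congˡ (*-congˡ (eval-quotient z (d ∷ ds) x)) ⟩
    c + x * (e + (x - z) * q)
      ≈⟨ solve 5 (λ c x z e q → c :+ x :* (e :+ (x :- z) :* q) := c :+ z :* e :+ (x :- z) :* (e :+ x :* q)) refl c x z e q ⟩
    c + z * e + (x - z) * (e + x * q) ∎
    where
    e q : Carrier
    e = eval K (d ∷ ds) z
    q = eval K (quotient z (d ∷ ds)) x

  private
    head-zero : ∀ z c f → eval K (c ∷ f) z ≈ 0# → eval K f z ≈ 0# → c ≈ 0#
    head-zero z c f root f≈0 = begin
      c                    ≈⟨ solve 2 (λ c z → c := c :+ z :* :0) refl c z ⟩
      c + z * 0#           ≈⟨ +-congˡ (*-congˡ f≈0) ⟨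
      c + z * eval K f z   ≈⟨ root ⟩
      0#                   ∎

  quotient-zero⇒zero : ∀ z f → eval K f z ≈ 0# → All (_≈ 0#) (quotient z f) → All (_≈ 0#) f
  quotient-zero⇒zero z []           _  _        = []
  quotient-zero⇒zero z (c ∷ [])     fz _        = head-zero z c [] fz refl ∷ []
  quotient-zero⇒zero z (c ∷ d ∷ ds) fz (e ∷ es) = head-zero z c (d ∷ ds) fz e ∷ quotient-zero⇒zero z (d ∷ ds) e es

  vanishingPolynomial : List Carrier → List Carrier
  vanishingPolynomial []      = 1# ∷ []
  vanishingPolynomial (s ∷ S) = (- s) ⋆ P ⊕ (0# ∷ P)
    where
    P : List Carrier
    P = vanishingPolynomial S

  eval-vanishingPolynomial : ∀ s S x →
    eval K (vanishingPolynomial (s ∷ S)) x ≈ (x - s) * eval K (vanishingPolynomial S) x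
  eval-vanishingPolynomial s S x = begin
    eval K ((- s) ⋆ P ⊕ (0# ∷ P)) x           ≈⟨ eval-⊕ ((- s) ⋆ P) (0# ∷ P) x ⟩
    eval K ((- s) ⋆ P) x + (0# + x * p)       ≈⟨ +-congʳ (eval-⋆ (- s) P x) ⟩
    - s * p + (0# + x * p)                    ≈⟨ solve 3 (λ s x p → :- s :* p :+ (:0 :+ x :* p) := (x :- s) :* p) refl s x p ⟩
    (x - s) * p                               ∎
    where
    P : List Carrier
    P = vanishingPolynomial S
    p : Carrier
    p = eval K P x

  invertible⇒apart : ∀ S x → Invertible (eval K (vanishingPolynomial S) x) → ApartFrom S x
  invertible⇒apart []      x _             = []
  invertible⇒apart (s ∷ S) x (w , Pw≈1) = (p * w , invert-left) ∷ invertible⇒apart S x ((x - s) * w , invert-right)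
    where
    p : Carrier
    p = eval K (vanishingPolynomial S) x
    [x-s]p≈P : (x - s) * p ≈ eval K (vanishingPolynomial (s ∷ S)) x
    [x-s]p≈P = sym (eval-vanishingPolynomial s S x)
    invert-left : (x - s) * (p * w) ≈ 1#
    invert-left = trans (sym (*-assoc _ p w)) (trans (*-congʳ [x-s]p≈P) Pw≈1)
    invert-right : p * ((x - s) * w) ≈ 1#
    invert-right = trans (sym (*-assoc p _ w)) (trans (*-congʳ (trans (*-comm p _) [x-s]p≈P)) Pw≈1)

  data Monic : List Carrier → Set c where
    [1#] : Monic (1# ∷ [])
    _∷_  : ∀ a {f} → Monic f → Monic (a ∷ f)

  ⊕-monic : ∀ f {g} → Monic g → length f ℕ.< length g → Monic (f ⊕ g)
  ⊕-monic []      g-monic        _               = g-monic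
  ⊕-monic (a ∷ f) [1#]           (ℕ.s≤s ())
  ⊕-monic (a ∷ f) (b ∷ g-monic)  (ℕ.s≤s |f|<|g|) = a + b ∷ ⊕-monic f g-monic |f|<|g|

  monic-vanishingPolynomial : ∀ S → Monic (vanishingPolynomial S)
  monic-vanishingPolynomial []      = [1#]
  monic-vanishingPolynomial (s ∷ S) =
    ⊕-monic ((- s) ⋆ P) (0# ∷ monic-vanishingPolynomial S) (ℕ.≤-reflexive (≡.cong suc (List.length-map (- s *_) P)))
    where
    P : List Carrier
    P = vanishingPolynomial S

  monic⇒nonzero : ∀ {f} → Monic f → Any (λ a → ¬ a ≈ 0#) f
  monic⇒nonzero [1#]            = here λ 1≈0 → 0≉1 (sym 1≈0)
  monic⇒nonzero (_ ∷ f-monic)   = there (monic⇒nonzero f-monic)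

  zero⇒vanishes : ∀ {f} → All (_≈ 0#) f → ∀ x → eval K f x ≈ 0#
  zero⇒vanishes []       x = refl
  zero⇒vanishes (e ∷ es) x = trans (+-cong e (*-congˡ (zero⇒vanishes es x))) (trans (+-identityˡ _) (zeroʳ x))

  eval-difference : ∀ f g x → eval K (f ⊕ ⊝ g) x ≈ eval K f x - eval K g x
  eval-difference f g x = trans (eval-⊕ f (⊝ g) x) (+-congˡ (eval-⊝ g x))

  module _ (closed : AlgebraicallyClosed K) where

    -- A root of X ∏ₛ (X - s) - 1.
    apart-point : ∀ S → ∃ (ApartFrom S)
    apart-point S with closed (- 1# ∷ vanishingPolynomial S) (monic⇒nonzero (monic-vanishingPolynomial S))
    ... | z , root = z , invertible⇒apart S z (z , Pz≈1)
      where
      Pz≈1 : eval K (vanishingPolynomial S) z * z ≈ 1#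
      Pz≈1 = begin
        p * z                     ≈⟨ solve 2 (λ p z → p :* z := :- :1 :+ z :* p :+ :1) refl p z ⟩
        - 1# + z * p + 1#         ≈⟨ +-congʳ root ⟩
        0# + 1#                   ≈⟨ +-identityˡ 1# ⟩
        1#                        ∎
        where
        p : Carrier
        p = eval K (vanishingPolynomial S) z

    vanishes-off⇒zero : ∀ S f → (∀ x → ApartFrom S x → eval K f x ≈ 0#) → All (_≈ 0#) f
    vanishes-off⇒zero S f = induct (length f) S f ≡.refl
      where
      induct : ∀ n S f → length f ≡ n → (∀ x → ApartFrom S x → eval K f x ≈ 0#) → All (_≈ 0#) f
      induct _       S []       _   _        = []
      induct (suc n) S f@(c ∷ cs) |f| f-vanishes with apart-point S
      ... | z , z#S = quotient-zero⇒zero z f (f-vanishes z z#S)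
                        (induct n (z ∷ S) (quotient z f) |quotient| q-vanishes)
        where
        |quotient| : length (quotient z f) ≡ n
        |quotient| = ≡.trans (length-quotient z c cs) (ℕ.suc-injective |f|)
        q-vanishes : ∀ x → ApartFrom (z ∷ S) x → eval K (quotient z f) x ≈ 0#
        q-vanishes x (x-z-invertible ∷ x#S) = invertible-*-zero x-z-invertible (begin
          (x - z) * q                     ≈⟨ solve 2 (λ e t → t := e :+ t :- e) refl (eval K f z) _ ⟩
          (eval K f z + (x - z) * q) - eval K f z  ≈⟨ +-cong (sym (eval-quotient z f x)) (-‿cong (f-vanishes z z#S)) ⟩
          eval K f x - 0#                 ≈⟨ +-congʳ (f-vanishes x x#S) ⟩
          0# - 0#                         ≈⟨ -‿inverseʳ 0# ⟩
          0#                              ∎)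
          where
          q : Carrier
          q = eval K (quotient z f) x

    vanishes⇒zero : ∀ f → (∀ x → eval K f x ≈ 0#) → All (_≈ 0#) f
    vanishes⇒zero f f-vanishes = vanishes-off⇒zero [] f (λ x _ → f-vanishes x)

    agree-off⇒agree : ∀ S f g → (∀ x → ApartFrom S x → eval K f x ≈ eval K g x) →
                      ∀ x → eval K f x ≈ eval K g x
    agree-off⇒agree S f g agree x = x∙y⁻¹≈ε⇒x≈y _ _ (begin
      eval K f x - eval K g x   ≈⟨ eval-difference f g x ⟨
      eval K (f ⊕ ⊝ g) x        ≈⟨ zero⇒vanishes (vanishes-off⇒zero S (f ⊕ ⊝ g) difference-vanishes) x ⟩
      0#                        ∎)
      where
      difference-vanishes : ∀ x → ApartFrom S x → eval K (f ⊕ ⊝ g) x ≈ 0#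
      difference-vanishes x x#S = trans (eval-difference f g x) (x≈y⇒x∙y⁻¹≈ε (agree x x#S))

    agree⇒difference-zero : ∀ f g → (∀ x → eval K f x ≈ eval K g x) → All (_≈ 0#) (f ⊕ ⊝ g)
    agree⇒difference-zero f g agree =
      vanishes⇒zero (f ⊕ ⊝ g) λ x → trans (eval-difference f g x) (x≈y⇒x∙y⁻¹≈ε (agree x))

    agree⇒leading-zero : ∀ f g c → length f ℕ.≤ length g →
                         (∀ x → eval K f x ≈ eval K (g ∷ʳ c) x) → c ≈ 0#
    agree⇒leading-zero f g c |f|≤|g| agree =
      ⁻¹-injective (trans (negated-leading f g |f|≤|g| (agree⇒difference-zero f (g ∷ʳ c) agree)) (sym ε⁻¹≈ε))
      where
      negated-leading : ∀ f g → length f ℕ.≤ length g → All (_≈ 0#) (f ⊕ ⊝ (g ∷ʳ c)) → - c ≈ 0#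
      negated-leading []      []      _                (e ∷ [])  = e
      negated-leading []      (d ∷ g) _                (_ ∷ es)  = negated-leading [] g ℕ.z≤n es
      negated-leading (a ∷ f) (d ∷ g) (ℕ.s≤s |f|≤|g|)  (_ ∷ es)  = negated-leading f g |f|≤|g| es

  eval-scaled-product : ∀ k {w₀ w₁ w₂ w₃} p₀ p₁ p₂ p₃ t →
    w₀ ≈ eval K p₀ t → w₁ ≈ eval K p₁ t → w₂ ≈ eval K p₂ t → w₃ ≈ eval K p₃ t →
    k * (w₀ * w₁ * w₂ * w₃) ≈ eval K (k ⋆ (p₀ ⊗ p₁ ⊗ p₂ ⊗ p₃)) t
  eval-scaled-product k {w₀} {w₁} {w₂} {w₃} p₀ p₁ p₂ p₃ t e₀ e₁ e₂ e₃ = begin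
    k * (w₀ * w₁ * w₂ * w₃)
      ≈⟨ *-congˡ (*-cong (*-cong (*-cong e₀ e₁) e₂) e₃) ⟩
    k * (eval K p₀ t * eval K p₁ t * eval K p₂ t * eval K p₃ t)
      ≈⟨ *-congˡ (*-congʳ (*-congʳ (eval-⊗ p₀ p₁ t))) ⟨
    k * (eval K (p₀ ⊗ p₁) t * eval K p₂ t * eval K p₃ t)
      ≈⟨ *-congˡ (*-congʳ (eval-⊗ (p₀ ⊗ p₁) p₂ t)) ⟨
    k * (eval K (p₀ ⊗ p₁ ⊗ p₂) t * eval K p₃ t)
      ≈⟨ *-congˡ (eval-⊗ (p₀ ⊗ p₁ ⊗ p₂) p₃ t) ⟨
    k * eval K (p₀ ⊗ p₁ ⊗ p₂ ⊗ p₃) t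
      ≈⟨ eval-⋆ k (p₀ ⊗ p₁ ⊗ p₂ ⊗ p₃) t ⟨
    eval K (k ⋆ (p₀ ⊗ p₁ ⊗ p₂ ⊗ p₃)) t ∎

module LinearForms {c ℓ : Level} (K : Field c ℓ) where
  open Field K
  open IntegerRingSolver commutativeRing using (solve; _:=_; _:+_; _:*_; _:-_; :-_; :0)
  open import Relation.Binary.Reasoning.Setoid setoid

  record LinearForm : Set c where
    constructor linear
    field
      α β γ : Carrier

  open LinearForm public

  ⟦_⟧ₗ : LinearForm → Carrier → Carrier → Carrier
  ⟦ m ⟧ₗ x y = α m * x + β m * y + γ m

  Π : Carrier → (m₀ m₁ m₂ m₃ : LinearForm) → Carrier → Carrier → Carrier
  Π k m₀ m₁ m₂ m₃ x y = k * (⟦ m₀ ⟧ₗ x y * ⟦ m₁ ⟧ₗ x y * ⟦ m₂ ⟧ₗ x y * ⟦ m₃ ⟧ₗ x y)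

  Π-rotate : ∀ k m₀ m₁ m₂ m₃ x y → Π k m₀ m₁ m₂ m₃ x y ≈ Π k m₁ m₂ m₃ m₀ x y
  Π-rotate k m₀ m₁ m₂ m₃ x y =
    solve 5 (λ k w₀ w₁ w₂ w₃ → k :* (w₀ :* w₁ :* w₂ :* w₃) := k :* (w₁ :* w₂ :* w₃ :* w₀)) refl
      k (⟦ m₀ ⟧ₗ x y) (⟦ m₁ ⟧ₗ x y) (⟦ m₂ ⟧ₗ x y) (⟦ m₃ ⟧ₗ x y)

  separated-exchange : ∀ m x₁ y₁ x₂ y₂ → α m * β m ≈ 0# →
    ⟦ m ⟧ₗ x₁ y₁ * ⟦ m ⟧ₗ x₂ y₂ ≈ ⟦ m ⟧ₗ x₁ y₂ * ⟦ m ⟧ₗ x₂ y₁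
  separated-exchange (linear α β γ) x₁ y₁ x₂ y₂ αβ≈0 = begin
    (α * x₁ + β * y₁ + γ) * (α * x₂ + β * y₂ + γ)
      ≈⟨ solve 7 (λ α β γ x₁ y₁ x₂ y₂ → (α :* x₁ :+ β :* y₁ :+ γ) :* (α :* x₂ :+ β :* y₂ :+ γ)
                   := (α :* x₁ :+ β :* y₂ :+ γ) :* (α :* x₂ :+ β :* y₁ :+ γ) :+ α :* β :* ((x₂ :- x₁) :* (y₁ :- y₂)))
           refl α β γ x₁ y₁ x₂ y₂ ⟩
    (α * x₁ + β * y₂ + γ) * (α * x₂ + β * y₁ + γ) + α * β * ((x₂ - x₁) * (y₁ - y₂))
      ≈⟨ +-congˡ (trans (*-congʳ αβ≈0) (zeroˡ _)) ⟩
    (α * x₁ + β * y₂ + γ) * (α * x₂ + β * y₁ + γ) + 0#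
      ≈⟨ +-identityʳ _ ⟩
    (α * x₁ + β * y₂ + γ) * (α * x₂ + β * y₁ + γ) ∎

  private
    interleave : ∀ k a₀ a₁ a₂ a₃ b₀ b₁ b₂ b₃ →
      k * (a₀ * a₁ * a₂ * a₃) * (k * (b₀ * b₁ * b₂ * b₃)) ≈
      k * k * (a₀ * b₀ * (a₁ * b₁) * (a₂ * b₂) * (a₃ * b₃))
    interleave = solve 9 (λ k a₀ a₁ a₂ a₃ b₀ b₁ b₂ b₃ →
      k :* (a₀ :* a₁ :* a₂ :* a₃) :* (k :* (b₀ :* b₁ :* b₂ :* b₃))
      := k :* k :* (a₀ :* b₀ :* (a₁ :* b₁) :* (a₂ :* b₂) :* (a₃ :* b₃))) refl

  separated-Π-rank-one : ∀ k m₀ m₁ m₂ m₃ →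
    α m₀ * β m₀ ≈ 0# → α m₁ * β m₁ ≈ 0# → α m₂ * β m₂ ≈ 0# → α m₃ * β m₃ ≈ 0# →
    ∀ x y → Π k m₀ m₁ m₂ m₃ x y * Π k m₀ m₁ m₂ m₃ 0# 0# ≈
            Π k m₀ m₁ m₂ m₃ x 0# * Π k m₀ m₁ m₂ m₃ 0# y
  separated-Π-rank-one k m₀ m₁ m₂ m₃ s₀ s₁ s₂ s₃ x y = begin
    k * (w₀ x y * w₁ x y * w₂ x y * w₃ x y) * (k * (w₀ 0# 0# * w₁ 0# 0# * w₂ 0# 0# * w₃ 0# 0#))
      ≈⟨ interleave k (w₀ x y) (w₁ x y) (w₂ x y) (w₃ x y) (w₀ 0# 0#) (w₁ 0# 0#) (w₂ 0# 0#) (w₃ 0# 0#) ⟩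
    k * k * (w₀ x y * w₀ 0# 0# * (w₁ x y * w₁ 0# 0#) * (w₂ x y * w₂ 0# 0#) * (w₃ x y * w₃ 0# 0#))
      ≈⟨ *-congˡ (*-cong (*-cong (*-cong (exchange m₀ s₀) (exchange m₁ s₁)) (exchange m₂ s₂))
                         (exchange m₃ s₃)) ⟩
    k * k * (w₀ x 0# * w₀ 0# y * (w₁ x 0# * w₁ 0# y) * (w₂ x 0# * w₂ 0# y) * (w₃ x 0# * w₃ 0# y))
      ≈⟨ interleave k (w₀ x 0#) (w₁ x 0#) (w₂ x 0#) (w₃ x 0#) (w₀ 0# y) (w₁ 0# y) (w₂ 0# y) (w₃ 0# y) ⟨
    k * (w₀ x 0# * w₁ x 0# * w₂ x 0# * w₃ x 0#) * (k * (w₀ 0# y * w₁ 0# y * w₂ 0# y * w₃ 0# y)) ∎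
    where
    w₀ w₁ w₂ w₃ : Carrier → Carrier → Carrier
    w₀ = ⟦ m₀ ⟧ₗ
    w₁ = ⟦ m₁ ⟧ₗ
    w₂ = ⟦ m₂ ⟧ₗ
    w₃ = ⟦ m₃ ⟧ₗ
    exchange : ∀ m → α m * β m ≈ 0# → ⟦ m ⟧ₗ x y * ⟦ m ⟧ₗ 0# 0# ≈ ⟦ m ⟧ₗ x 0# * ⟦ m ⟧ₗ 0# y
    exchange m = separated-exchange m x y 0# 0#

  ⟦⟧ₗ-in-x : ∀ m x y → ⟦ m ⟧ₗ x y ≈ eval K (β m * y + γ m ∷ α m ∷ []) x
  ⟦⟧ₗ-in-x (linear α β γ) x y = solve 5 (λ α β γ x y →
    α :* x :+ β :* y :+ γ := β :* y :+ γ :+ x :* (α :+ x :* :0)) refl α β γ x y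

  ⟦⟧ₗ-on-line : ∀ m u v t → ⟦ m ⟧ₗ (t * u) (t * v) ≈ eval K (γ m ∷ α m * u + β m * v ∷ []) t
  ⟦⟧ₗ-on-line (linear α β γ) u v t = solve 6 (λ α β γ u v t →
    α :* (t :* u) :+ β :* (t :* v) :+ γ := γ :+ t :* (α :* u :+ β :* v :+ t :* :0)) refl α β γ u v t

  ⟦⟧ₗ-on-kernel-line : ∀ m t → ⟦ m ⟧ₗ (t * β m) (t * - α m) ≈ eval K (γ m ∷ []) t
  ⟦⟧ₗ-on-kernel-line (linear α β γ) t = solve 4 (λ α β γ t →
    α :* (t :* β) :+ β :* (t :* :- α) :+ γ := γ :+ t :* :0) refl α β γ t

-- C stands for A a - B b (see numerator-factorisation); everything else holds for an arbitrary C.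
module Curve {c ℓ : Level} (K : Field c ℓ) (A a B b C : Field.Carrier K) where

  open Field K

  open Invertibility K
  open Polynomials K
  open LinearForms K
  open IntegerRingSolver commutativeRing using (solve; _:=_; _:+_; _:*_; _:-_; :-_; _:^_; Polynomial; :0; :1)
  open import Relation.Binary.Reasoning.Setoid setoid
  open import Algebra.Properties.Group +-group using (x∙y⁻¹≈ε⇒x≈y; x≈y⇒x∙y⁻¹≈ε; ⁻¹-injective; ε⁻¹≈ε)
  open import Algebra.Properties.Ring ring using (-0#≈0#)

  N D : Carrier → Carrier
  N x = A * pow K x 3 + pow K x 2 + B
  D x = b * pow K x 3 + x + a

  F : Carrier → Carrier → Carrier
  F x y = - (b * (x * x) * (y * y)) + A * (x * x * y + x * y * y) + C * (x * x + x * y + y * y) + x * y + a * (x + y) - B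

  private
    F: : ∀ {n} (A a B b C x y : Polynomial n) → Polynomial n
    F: A a B b C x y = :- (b :* (x :* x) :* (y :* y)) :+ A :* (x :* x :* y :+ x :* y :* y)
      :+ C :* (x :* x :+ x :* y :+ y :* y) :+ x :* y :+ a :* (x :+ y) :- B

  numerator-factorisation : C ≈ A * a - B * b → ∀ x y → N x * D y - N y * D x ≈ (x - y) * F x y
  numerator-factorisation C≈Aa-Bb x y = begin
    N x * D y - N y * D x
      ≈⟨ solve 7 (λ A a B b C x y →
           (A :* x :^ 3 :+ x :^ 2 :+ B) :* (b :* y :^ 3 :+ y :+ a) :- (A :* y :^ 3 :+ y :^ 2 :+ B) :* (b :* x :^ 3 :+ x :+ a)
           := (x :- y) :* (F: A a B b C x y :+ (A :* a :- B :* b :- C) :* (x :* x :+ x :* y :+ y :* y))) refl A a B b C x y ⟩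
    (x - y) * (F x y + (A * a - B * b - C) * (x * x + x * y + y * y))
      ≈⟨ *-congˡ (+-congˡ (trans (*-congʳ (x≈y⇒x∙y⁻¹≈ε (sym C≈Aa-Bb))) (zeroˡ _))) ⟩
    (x - y) * (F x y + 0#)
      ≈⟨ *-congˡ (+-identityʳ _) ⟩
    (x - y) * F x y ∎

  F-in-x : Carrier → List Carrier
  F-in-x y = C * (y * y) + a * y - B ∷ A * (y * y) + (C + 1#) * y + a ∷ - b * (y * y) + A * y + C ∷ []

  eval-F-in-x : ∀ x y → F x y ≈ eval K (F-in-x y) x
  eval-F-in-x x y = solve 7 (λ A a B b C x y → F: A a B b C x y
    := C :* (y :* y) :+ a :* y :- B :+ x :* (A :* (y :* y) :+ (C :+ :1) :* y :+ a
         :+ x :* (:- b :* (y :* y) :+ A :* y :+ C :+ x :* :0))) refl A a B b C x y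

  F-along-lower : Carrier → Carrier → List Carrier
  F-along-lower u v = - B ∷ a * (u + v) ∷ C * (u * u + u * v + v * v) + u * v ∷ A * (u * u * v + u * v * v) ∷ []

  F-along : Carrier → Carrier → List Carrier
  F-along u v = F-along-lower u v ∷ʳ - (b * (u * u) * (v * v))

  eval-F-along : ∀ u v t → F (t * u) (t * v) ≈ eval K (F-along u v) t
  eval-F-along u v t = solve 8 (λ A a B b C u v t → F: A a B b C (t :* u) (t :* v)
    := :- B :+ t :* (a :* (u :+ v) :+ t :* (C :* (u :* u :+ u :* v :+ v :* v) :+ u :* v
         :+ t :* (A :* (u :* u :* v :+ u :* v :* v) :+ t :* (:- (b :* (u :* u) :* (v :* v)) :+ t :* :0))))) refl A a B b C u v t

  rank-defect₁ rank-defect₂ : List Carrier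
  rank-defect₁ = 0# ∷ - (B * (C + 1#)) - a * a ∷ - (A * B) - a * C ∷ []
  rank-defect₂ = 0# ∷ - (A * B) - a * C ∷ b * B - C * C ∷ []

  eval-rank-defect : ∀ x y →
    F x y * F 0# 0# - F x 0# * F 0# y ≈ eval K (0# ∷ eval K rank-defect₁ x ∷ eval K rank-defect₂ x ∷ []) y
  eval-rank-defect x y = solve 7 (λ x y A a B b C →
      F: A a B b C x y :* F: A a B b C :0 :0 :- F: A a B b C x :0 :* F: A a B b C :0 y
      := :0 :+ y :* (d₁ A a B C x :+ y :* (d₂ A a B b C x :+ y :* :0))) refl x y A a B b C
    where
    d₁ : ∀ {n} (A a B C x : Polynomial n) → Polynomial n
    d₁ A a B C x = :0 :+ x :* (:- (B :* (C :+ :1)) :- a :* a :+ x :* (:- (A :* B) :- a :* C :+ x :* :0))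
    d₂ : ∀ {n} (A a B b C x : Polynomial n) → Polynomial n
    d₂ A a B b C x = :0 :+ x :* (:- (A :* B) :- a :* C :+ x :* (b :* B :- C :* C :+ x :* :0))

  module _ (closed : AlgebraicallyClosed K) where

    Π≈F : C ≈ A * a - B * b → ∀ k m₀ m₁ m₂ m₃ →
          (∀ x y → (x - y) * Π k m₀ m₁ m₂ m₃ x y ≈ N x * D y - N y * D x) →
          ∀ x y → Π k m₀ m₁ m₂ m₃ x y ≈ F x y
    Π≈F C≈Aa-Bb k m₀ m₁ m₂ m₃ H x y = begin
      Π k m₀ m₁ m₂ m₃ x y   ≈⟨ Π-in-x x ⟩
      eval K ΠX x           ≈⟨ agree-off⇒agree closed (y ∷ []) ΠX (F-in-x y) agree x ⟩
      eval K (F-in-x y) x   ≈⟨ eval-F-in-x x y ⟨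
      F x y                 ∎
      where
      in-x : LinearForm → List Carrier
      in-x m = β m * y + γ m ∷ α m ∷ []
      ΠX : List Carrier
      ΠX = k ⋆ (in-x m₀ ⊗ in-x m₁ ⊗ in-x m₂ ⊗ in-x m₃)
      Π-in-x : ∀ x → Π k m₀ m₁ m₂ m₃ x y ≈ eval K ΠX x
      Π-in-x x = eval-scaled-product k (in-x m₀) (in-x m₁) (in-x m₂) (in-x m₃) x
                   (⟦⟧ₗ-in-x m₀ x y) (⟦⟧ₗ-in-x m₁ x y) (⟦⟧ₗ-in-x m₂ x y) (⟦⟧ₗ-in-x m₃ x y)
      agree : ∀ x → ApartFrom (y ∷ []) x → eval K ΠX x ≈ eval K (F-in-x y) x
      agree x (x-y-invertible ∷ []) = *-cancelˡ-invertible x-y-invertible (begin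
        (x - y) * eval K ΠX x           ≈⟨ *-congˡ (Π-in-x x) ⟨
        (x - y) * Π k m₀ m₁ m₂ m₃ x y   ≈⟨ H x y ⟩
        N x * D y - N y * D x           ≈⟨ numerator-factorisation C≈Aa-Bb x y ⟩
        (x - y) * F x y                 ≈⟨ *-congˡ (eval-F-in-x x y) ⟩
        (x - y) * eval K (F-in-x y) x   ∎)

    module _ (reduced : ∀ x → x * x ≈ 0# → x ≈ 0#) (b-invertible : Invertible b) where

      kernel-line-separated : ∀ k m m₁ m₂ m₃ → (∀ x y → Π k m m₁ m₂ m₃ x y ≈ F x y) → α m * β m ≈ 0#
      kernel-line-separated k m m₁ m₂ m₃ Π≈F = reduced (α m * β m) (invertible-*-zero b-invertible b[αβ]²≈0)
        where
        u v : Carrier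
        u = β m
        v = - α m
        along : LinearForm → List Carrier
        along mᵢ = γ mᵢ ∷ α mᵢ * u + β mᵢ * v ∷ []
        P : List Carrier
        P = k ⋆ ((γ m ∷ []) ⊗ along m₁ ⊗ along m₂ ⊗ along m₃)
        agree : ∀ t → eval K P t ≈ eval K (F-along u v) t
        agree t = begin
          eval K P t
            ≈⟨ eval-scaled-product k (γ m ∷ []) (along m₁) (along m₂) (along m₃) t (⟦⟧ₗ-on-kernel-line m t)
                 (⟦⟧ₗ-on-line m₁ u v t) (⟦⟧ₗ-on-line m₂ u v t) (⟦⟧ₗ-on-line m₃ u v t) ⟨
          Π k m m₁ m₂ m₃ (t * u) (t * v)    ≈⟨ Π≈F (t * u) (t * v) ⟩
          F (t * u) (t * v)                 ≈⟨ eval-F-along u v t ⟩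
          eval K (F-along u v) t            ∎
        b[αβ]²≈0 : b * (α m * β m * (α m * β m)) ≈ 0#
        b[αβ]²≈0 = begin
          b * (α m * β m * (α m * β m))
            ≈⟨ solve 3 (λ b α β → b :* (α :* β :* (α :* β)) := :- (:- (b :* (β :* β) :* (:- α :* :- α))))
                 refl b (α m) (β m) ⟩
          - (- (b * (u * u) * (v * v)))
            ≈⟨ -‿cong (agree⇒leading-zero closed P (F-along-lower u v) _ ℕ.≤-refl agree) ⟩
          - 0#
            ≈⟨ -0#≈0# ⟩
          0# ∎

      F-rank-one : ∀ k m₀ m₁ m₂ m₃ → (∀ x y → Π k m₀ m₁ m₂ m₃ x y ≈ F x y) →
                   ∀ x y → F x y * F 0# 0# ≈ F x 0# * F 0# y
      F-rank-one k m₀ m₁ m₂ m₃ Π₀≈F x y = begin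
        F x y * F 0# 0#                                ≈⟨ *-cong (Π₀≈F x y) (Π₀≈F 0# 0#) ⟨
        Π k m₀ m₁ m₂ m₃ x y * Π k m₀ m₁ m₂ m₃ 0# 0#    ≈⟨ separated-Π-rank-one k m₀ m₁ m₂ m₃
                                                            (kernel-line-separated k m₀ m₁ m₂ m₃ Π₀≈F)
                                                            (kernel-line-separated k m₁ m₂ m₃ m₀ Π₁≈F)
                                                            (kernel-line-separated k m₂ m₃ m₀ m₁ Π₂≈F)
                                                            (kernel-line-separated k m₃ m₀ m₁ m₂ Π₃≈F) x y ⟩
        Π k m₀ m₁ m₂ m₃ x 0# * Π k m₀ m₁ m₂ m₃ 0# y    ≈⟨ *-cong (Π₀≈F x 0#) (Π₀≈F 0# y) ⟩
        F x 0# * F 0# y                                ∎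
        where
        Π₁≈F : ∀ x y → Π k m₁ m₂ m₃ m₀ x y ≈ F x y
        Π₁≈F x y = trans (sym (Π-rotate k m₀ m₁ m₂ m₃ x y)) (Π₀≈F x y)
        Π₂≈F : ∀ x y → Π k m₂ m₃ m₀ m₁ x y ≈ F x y
        Π₂≈F x y = trans (sym (Π-rotate k m₁ m₂ m₃ m₀ x y)) (Π₁≈F x y)
        Π₃≈F : ∀ x y → Π k m₃ m₀ m₁ m₂ x y ≈ F x y
        Π₃≈F x y = trans (sym (Π-rotate k m₂ m₃ m₀ m₁ x y)) (Π₂≈F x y)

    rank-one⇒relations : (∀ x y → F x y * F 0# 0# ≈ F x 0# * F 0# y) →
      - (A * B) ≈ a * C × b * B ≈ C * C × - (B * (C + 1#)) ≈ a * a
    rank-one⇒relations rank-one =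
      relations (vanishes⇒zero closed rank-defect₁ (proj₁ ∘ in-y))
                (vanishes⇒zero closed rank-defect₂ (proj₂ ∘ in-y))
      where
      in-y : ∀ x → eval K rank-defect₁ x ≈ 0# × eval K rank-defect₂ x ≈ 0#
      in-y x = linear-quadratic (vanishes⇒zero closed (0# ∷ eval K rank-defect₁ x ∷ eval K rank-defect₂ x ∷ [])
                 (λ y → trans (sym (eval-rank-defect x y)) (x≈y⇒x∙y⁻¹≈ε (rank-one x y))))
        where
        linear-quadratic : ∀ {c₀ c₁ c₂} → All (_≈ 0#) (c₀ ∷ c₁ ∷ c₂ ∷ []) → c₁ ≈ 0# × c₂ ≈ 0#
        linear-quadratic (_ ∷ e₁ ∷ e₂ ∷ []) = e₁ , e₂
      relations : All (_≈ 0#) rank-defect₁ → All (_≈ 0#) rank-defect₂ →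
                  - (A * B) ≈ a * C × b * B ≈ C * C × - (B * (C + 1#)) ≈ a * a
      relations (_ ∷ R₃ ∷ _ ∷ []) (_ ∷ R₁ ∷ R₂ ∷ []) =
        x∙y⁻¹≈ε⇒x≈y _ _ R₁ , x∙y⁻¹≈ε⇒x≈y _ _ R₂ , x∙y⁻¹≈ε⇒x≈y _ _ R₃

  module _ (b-invertible : Invertible b) (B-invertible : Invertible B)
           (R₁ : - (A * B) ≈ a * C) (R₂ : b * B ≈ C * C) (R₃ : - (B * (C + 1#)) ≈ a * a) where

    C-invertible : Invertible C
    C-invertible with invertible-* b-invertible B-invertible
    ... | w , bBw≈1 = C * w , trans (sym (*-assoc C C w)) (trans (*-congʳ (sym R₂)) bBw≈1)

    -AC≈ab : - (A * C) ≈ a * b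
    -AC≈ab = *-cancelʳ-invertible C-invertible (begin
      - (A * C) * C     ≈⟨ solve 2 (λ A C → :- (A :* C) :* C := :- (A :* (C :* C))) refl A C ⟩
      - (A * (C * C))   ≈⟨ -‿cong (*-congˡ R₂) ⟨
      - (A * (b * B))   ≈⟨ solve 3 (λ A b B → :- (A :* (b :* B)) := b :* :- (A :* B)) refl A b B ⟩
      b * - (A * B)     ≈⟨ *-congˡ R₁ ⟩
      b * (a * C)       ≈⟨ solve 3 (λ a b C → b :* (a :* C) := a :* b :* C) refl a b C ⟩
      a * b * C         ∎)

    -AA≈b[1+C] : - (A * A) ≈ b * (1# + C)
    -AA≈b[1+C] = *-cancelʳ-invertible (invertible-* B-invertible B-invertible) (begin
      - (A * A) * (B * B)
        ≈⟨ solve 2 (λ A B → :- (A :* A) :* (B :* B) := :- (:- (A :* B) :* :- (A :* B))) refl A B ⟩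
      - (- (A * B) * - (A * B))        ≈⟨ -‿cong (*-cong R₁ R₁) ⟩
      - (a * C * (a * C))              ≈⟨ solve 2 (λ a C → :- (a :* C :* (a :* C)) := :- (a :* a :* (C :* C))) refl a C ⟩
      - (a * a * (C * C))              ≈⟨ -‿cong (*-congˡ R₂) ⟨
      - (a * a * (b * B))              ≈⟨ -‿cong (*-congʳ R₃) ⟨
      - (- (B * (C + 1#)) * (b * B))
        ≈⟨ solve 3 (λ B C b → :- (:- (B :* (C :+ :1)) :* (b :* B)) := b :* (:1 :+ C) :* (B :* B)) refl B C b ⟩
      b * (1# + C) * (B * B)           ∎)

    g : List Carrier
    g = C ∷ A ∷ - b ∷ []

    g·[C-Ax]≈b·N : ∀ x → eval K g x * eval K (C ∷ - A ∷ []) x ≈ b * N x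
    g·[C-Ax]≈b·N x = begin
      eval K g x * eval K (C ∷ - A ∷ []) x
        ≈⟨ solve 4 (λ A b C x → (C :+ x :* (A :+ x :* (:- b :+ x :* :0))) :* (C :+ x :* (:- A :+ x :* :0))
                                := C :* C :+ x :* x :* (:- (A :* A) :- b :* C) :+ x :^ 3 :* (A :* b)) refl A b C x ⟩
      C * C + x * x * (- (A * A) - b * C) + pow K x 3 * (A * b)
        ≈⟨ +-congʳ (+-cong (sym R₂) (*-congˡ (+-congʳ -AA≈b[1+C]))) ⟩
      b * B + x * x * (b * (1# + C) - b * C) + pow K x 3 * (A * b)
        ≈⟨ solve 5 (λ A B b C x → b :* B :+ x :* x :* (b :* (:1 :+ C) :- b :* C) :+ x :^ 3 :* (A :* b)
                                  := b :* (A :* x :^ 3 :+ x :^ 2 :+ B)) refl A B b C x ⟩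
      b * N x ∎

    g·[-A-bx]≈b·D : ∀ x → eval K g x * eval K (- A ∷ - b ∷ []) x ≈ b * D x
    g·[-A-bx]≈b·D x = begin
      eval K g x * eval K (- A ∷ - b ∷ []) x
        ≈⟨ solve 4 (λ A b C x → (C :+ x :* (A :+ x :* (:- b :+ x :* :0))) :* (:- A :+ x :* (:- b :+ x :* :0))
                                := :- (A :* C) :+ x :* (:- (A :* A) :- b :* C) :+ x :^ 3 :* (b :* b)) refl A b C x ⟩
      - (A * C) + x * (- (A * A) - b * C) + pow K x 3 * (b * b)
        ≈⟨ +-congʳ (+-cong -AC≈ab (*-congˡ (+-congʳ -AA≈b[1+C]))) ⟩
      a * b + x * (b * (1# + C) - b * C) + pow K x 3 * (b * b)
        ≈⟨ solve 4 (λ a b C x → a :* b :+ x :* (b :* (:1 :+ C) :- b :* C) :+ x :^ 3 :* (b :* b)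
                                := b :* (b :* x :^ 3 :+ x :+ a)) refl a b C x ⟩
      b * D x ∎

    relations⇒common-factor : ∃ λ g → Nonconstant K g ×
      (∃ λ u → ∀ x → eval K g x * eval K u x ≈ N x) × (∃ λ v → ∀ x → eval K g x * eval K v x ≈ D x)
    relations⇒common-factor =
      g , there (here -b≉0) , (b⁻¹ ⋆ (C ∷ - A ∷ []) , divide-by-b (C ∷ - A ∷ []) N g·[C-Ax]≈b·N)
        , (b⁻¹ ⋆ (- A ∷ - b ∷ []) , divide-by-b (- A ∷ - b ∷ []) D g·[-A-bx]≈b·D)
      where
      b⁻¹ : Carrier
      b⁻¹ = proj₁ b-invertible
      -b≉0 : ¬ - b ≈ 0#
      -b≉0 -b≈0 = invertible⇒≉0 b-invertible (⁻¹-injective (trans -b≈0 (sym ε⁻¹≈ε)))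
      divide-by-b : ∀ h (t : Carrier → Carrier) → (∀ x → eval K g x * eval K h x ≈ b * t x) →
                    ∀ x → eval K g x * eval K (b⁻¹ ⋆ h) x ≈ t x
      divide-by-b h t g·h≈b·t x = begin
        eval K g x * eval K (b⁻¹ ⋆ h) x   ≈⟨ *-congˡ (eval-⋆ b⁻¹ h x) ⟩
        eval K g x * (b⁻¹ * eval K h x)   ≈⟨ x∙yz≈y∙xz _ b⁻¹ _ ⟩
        b⁻¹ * (eval K g x * eval K h x)   ≈⟨ *-congˡ (g·h≈b·t x) ⟩
        b⁻¹ * (b * t x)                   ≈⟨ *-assoc b⁻¹ b (t x) ⟨
        b⁻¹ * b * t x                     ≈⟨ *-congʳ (trans (*-comm b⁻¹ b) (proj₂ b-invertible)) ⟩
        1# * t x                          ≈⟨ *-identityˡ (t x) ⟩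
        t x                               ∎
        where open import Algebra.Properties.CommutativeSemigroup *-commutativeSemigroup using (x∙yz≈y∙xz)

  factorisation⇒common-factor : AlgebraicallyClosed K → (∀ x → x * x ≈ 0# → x ≈ 0#) →
    ¬ b ≈ 0# → ¬ B ≈ 0# → C ≈ A * a - B * b →
    ∀ k m₀ m₁ m₂ m₃ → (∀ x y → (x - y) * Π k m₀ m₁ m₂ m₃ x y ≈ N x * D y - N y * D x) →
    ∃ λ g → Nonconstant K g ×
      (∃ λ u → ∀ x → eval K g x * eval K u x ≈ N x) × (∃ λ v → ∀ x → eval K g x * eval K v x ≈ D x)
  factorisation⇒common-factor closed reduced b≉0 B≉0 C≈Aa-Bb k m₀ m₁ m₂ m₃ H =
    let b-invertible = ≉0⇒invertible b≉0
        Π≈F′ = Π≈F closed C≈Aa-Bb k m₀ m₁ m₂ m₃ H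
        R₁ , R₂ , R₃ = rank-one⇒relations closed (F-rank-one closed reduced b-invertible k m₀ m₁ m₂ m₃ Π≈F′)
    in relations⇒common-factor b-invertible (≉0⇒invertible B≉0) R₁ R₂ R₃

module Powers {c ℓ : Level} (K : Field c ℓ) where
  open Field K
  open Invertibility K

  pow-invertible : ∀ {x} → Invertible x → ∀ n → Invertible (pow K x n)
  pow-invertible x-inv zero    = 1# , *-identityˡ 1#
  pow-invertible x-inv (suc n) = invertible-* x-inv (pow-invertible x-inv n)

  square-zero⇒pow-zero : ∀ {x} → x * x ≈ 0# → ∀ n → 2 ℕ.≤ n → pow K x n ≈ 0#
  square-zero⇒pow-zero x²≈0 (suc zero) (ℕ.s≤s ())
  square-zero⇒pow-zero {x} x²≈0 (suc (suc n)) _ =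
    trans (sym (*-assoc x x (pow K x n))) (trans (*-congʳ x²≈0) (zeroˡ _))

  algebraic⇒reduced : ∀ p → 2 ℕ.≤ p → (∀ x → ∃ λ n → 1 ℕ.≤ n × pow K x (p ℕ.^ n) ≈ x) →
                      ∀ x → x * x ≈ 0# → x ≈ 0#
  algebraic⇒reduced p@(suc _) 2≤p algebraic x x²≈0 with algebraic x
  ... | n , 1≤n , x^pⁿ≈x = trans (sym x^pⁿ≈x) (square-zero⇒pow-zero x²≈0 (p ℕ.^ n) 2≤pⁿ)
    where
    2≤pⁿ : 2 ℕ.≤ p ℕ.^ n
    2≤pⁿ = ℕ.≤-trans 2≤p (ℕ.≤-trans (ℕ.≤-reflexive (≡.sym (ℕ.*-identityʳ p))) (ℕ.^-monoʳ-≤ p 1≤n))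

theorem5p1 : ∀ {c ℓ : Level} (L : Field c ℓ) (p h : ℕ) → Prime p → 3 < p → 1 ≤ h →
    IsAlgebraicClosureOfFp L p →
    let open Field L
        q = p ℕ.^ h
        _^_ = pow L
    in (a b : Carrier) → (a ^ (q ℕ.* q)) ≈ a → (b ^ (q ℕ.* q)) ≈ b →
       ¬ (a ≈ 0#) → ¬ (b ≈ 0#) →
       let N : Carrier → Carrier
           N x = (((a ^ q) * (x ^ 3)) + (x ^ 2)) + (b ^ q)
           D : Carrier → Carrier
           D x = ((b * (x ^ 3)) + x) + a
       in (∃ λ (k : Carrier) → ∃ λ (α : Fin 4 → Carrier) → ∃ λ (β : Fin 4 → Carrier) → ∃ λ (γ : Fin 4 → Carrier) →
             ¬ (k ≈ 0#) ×
             (∀ i → ¬ ((α i ≈ 0#) × (β i ≈ 0#))) ×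
             (∀ x y → let ℓf = λ (i : Fin 4) → ((α i * x) + (β i * y)) + γ i
                      in ((x - y) * (k * (((ℓf Fin.zero * ℓf (Fin.suc Fin.zero)) * ℓf (Fin.suc (Fin.suc Fin.zero))) * ℓf (Fin.suc (Fin.suc (Fin.suc Fin.zero))))))
                         ≈ ((N x * D y) - (N y * D x))))
       → ∃ λ (g : List Carrier) → Nonconstant L g ×
           (∃ λ (u : List Carrier) → ∀ x → (eval L g x * eval L u x) ≈ N x) ×
           (∃ λ (v : List Carrier) → ∀ x → (eval L g x * eval L v x) ≈ D x)
theorem5p1 L p h _ 3<p _ (closed , _ , algebraic) a b _ _ _ b≉0 (k , α , β , γ , _ , _ , H) =
  factorisation⇒common-factor closed (algebraic⇒reduced p 2≤p algebraic) b≉0 bᵠ≉0 refl k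
    (form Fin.zero) (form (Fin.suc Fin.zero)) (form (Fin.suc (Fin.suc Fin.zero))) (form (Fin.suc (Fin.suc (Fin.suc Fin.zero)))) H
  where
  open Field L
  open Invertibility L
  open Powers L
  open LinearForms L using (linear; LinearForm)
  q : ℕ
  q = p ℕ.^ h
  open Curve L (pow L a q) a (pow L b q) b (pow L a q * a - pow L b q * b)
  form : Fin 4 → LinearForm
  form i = linear (α i) (β i) (γ i)
  2≤p : 2 ℕ.≤ p
  2≤p = ℕ.≤-trans (ℕ.n≤1+n 2) (ℕ.<⇒≤ 3<p)
  bᵠ≉0 : ¬ pow L b q ≈ 0#
  bᵠ≉0 = invertible⇒≉0 (pow-invertible (≉0⇒invertible b≉0) q)
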